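{- Let $k,n$ be integers with $1\leq k\leq n-2$, and let $G$ be a graph of order $n$. Then $\kappa(G)\geq k$ if and only if $sdiam_{n-k+1}(G)=n-k$.
   Context: $\kappa(G)$ denotes the vertex connectivity of $G$ (with $\kappa(G)=0$ if $G$ is disconnected and $\kappa(K_n)=n-1$). For $S\subseteq V(G)$, the Steiner distance $d_G(S)$ is the minimum number of edges of a connected subgraph of $G$ whose vertex set contains $S$, with $d_G(S)=\infty$ if no such subgraph exists. For $2\leq m\leq n$, the Steiner $m$-diameter is $sdiam_m(G)=\max\{d_G(S): S\subseteq V(G),\ |S|=m\}$ (equivalently, the maximum over vertices $v$ of the Steiner $m$-eccentricity $e_m(v)=\max\{d_G(S): |S|=m,\ v\in S\}$). -}

module Defs where

open import Data.Nat using (ℕ; zero; suc; _+_; _∸_; _≤_; _<_)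
open import Data.Nat.Properties using (_<?_)
open import Data.Bool using (Bool; true; false; if_then_else_)
open import Data.Fin using (Fin; toℕ)
open import Data.Fin.Subset using (Subset; _∈_; _∉_; _⊆_; ∣_∣)
open import Data.Product using (Σ; _×_; ∃)
open import Data.Sum using (_⊎_)
open import Relation.Nullary using (¬_; does)
open import Relation.Binary.PropositionalEquality using (_≡_)
open import Relation.Binary.Construct.Closure.ReflexiveTransitive using (Star)

record Graph (n : ℕ) : Set where
  field
    adj    : Fin n → Fin n → Bool
    sym    : ∀ u v → adj u v ≡ adj v u
    irrefl : ∀ u → adj u u ≡ false
open Graph public

sumFin : (n : ℕ) → (Fin n → ℕ) → ℕ
sumFin zero    f = 0
sumFin (suc n) f = f Fin.zero + sumFin n (λ i → f (Fin.suc i))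
  where import Data.Fin as Fin

Complete : ∀ {n} → Graph n → Set
Complete {n} G = ∀ (u v : Fin n) → ¬ (u ≡ v) → adj G u v ≡ true

DisconnectedAfterRemoving : ∀ {n} → Graph n → Subset n → Set
DisconnectedAfterRemoving {n} G X =
  Σ (Fin n) λ u → Σ (Fin n) λ v → u ∉ X × v ∉ X ×
    ¬ Star (λ a b → adj G a b ≡ true × a ∉ X × b ∉ X) u v

-- κ(G) = n-1 if G is complete, and otherwise
-- κ(G) = min { |X| : G - X is disconnected }.
-- "κ(G) ≥ k", literally unfolded:
ConnectivityAtLeast : ∀ {n} → Graph n → ℕ → Set
ConnectivityAtLeast {n} G k =
  (Complete G × k ≤ n ∸ 1)
  ⊎ (¬ Complete G × (∀ X → DisconnectedAfterRemoving G X → k ≤ ∣ X ∣))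

-- A connected subgraph H of G: vertex set U, edge set given by the
-- symmetric indicator F (F u v ≡ true iff uv ∈ E(H)).
record ConnectedSubgraph {n : ℕ} (G : Graph n) : Set where
  field
    U       : Subset n
    F       : Fin n → Fin n → Bool
    F-sym   : ∀ u v → F u v ≡ F v u
    F⊆E     : ∀ u v → F u v ≡ true → adj G u v ≡ true
    F-ends  : ∀ u v → F u v ≡ true → u ∈ U
    conn    : ∀ u v → u ∈ U → v ∈ U → Star (λ a b → F a b ≡ true) u v
open ConnectedSubgraph public

edgeCount : ∀ {n} {G : Graph n} → ConnectedSubgraph G → ℕ
edgeCount {n} H =
  sumFin n λ i → sumFin n λ j →
    if does (toℕ i <? toℕ j) then (if F H i j then 1 else 0) else 0

-- sdiam_m(G) = D (with D a finite value):
--   every m-set S has d_G(S) ≤ D, i.e. is contained in a connected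
--   subgraph with ≤ D edges, and some m-set S has d_G(S) ≥ D.
SteinerDiamIs : ∀ {n} → Graph n → ℕ → ℕ → Set
SteinerDiamIs {n} G m D =
  (∀ (S : Subset n) → ∣ S ∣ ≡ m →
     Σ (ConnectedSubgraph G) λ H → S ⊆ U H × edgeCount H ≤ D)
  × Σ (Subset n) λ S → ∣ S ∣ ≡ m ×
      (∀ (H : ConnectedSubgraph G) → S ⊆ U H → D ≤ edgeCount H)

-- A connected subgraph with vertex set U has at least |U| − 1 edges, with equality for a
-- spanning tree, which is grown from a single vertex by repeatedly attaching a leaf along an
-- edge that leaves the current vertex set.  Hence an m-set S has Steiner distance m − 1 if G[S]
-- is connected and at least m otherwise, so sdiam_m(G) = m − 1 exactly when no n − m vertices
-- separate G; for m = n − k + 1 this says κ(G) ≥ k.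

module Submission where

open import Defs
open import Data.Nat using (ℕ; zero; suc; _+_; _∸_; _≤_; _<_; z≤n; s≤s)
open import Data.Nat.Properties hiding (_≟_; suc-injective)
open import Data.Bool using (Bool; true; false; _∨_; if_then_else_) renaming (_≟_ to _≟ᵇ_)
open import Data.Bool.Properties using (∨-zeroʳ; ∨-identityʳ)
open import Data.Fin using (Fin; toℕ; _≟_) renaming (zero to fzero; suc to fsuc)
open import Data.Fin.Properties using (any?; all?; toℕ-injective; suc-injective)
open import Data.Fin.Subset using (Subset; _∈_; _∉_; _⊆_; ∣_∣; _∪_; ⁅_⁆; ∁; ⊥; ⊤; Nonempty; inside; outside)
open import Data.Fin.Subset.Properties
open import Data.Vec using ([]; _∷_; here)
open import Data.Product using (Σ; ∃; ∃₂; _×_; _,_; proj₁; proj₂)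
open import Data.Sum using (_⊎_; inj₁; inj₂)
open import Function using (_∘_)
open import Function.Bundles using (_⇔_; mk⇔)
open import Relation.Nullary using (¬_; Dec; yes; no; does; contradiction)
open import Relation.Nullary.Decidable using (_×-dec_; _⊎-dec_; _→-dec_; ¬?; dec-true; dec-false; does-⇔; decidable-stable)
open import Relation.Binary.PropositionalEquality as ≡ using (_≡_; _≢_; refl; cong; cong₂; subst; trans)
open import Relation.Binary.Construct.Closure.ReflexiveTransitive as Star using (Star; ε; _◅_; _◅◅_)
open import Relation.Binary using (tri<; tri≈; tri>)

∣p∪q∣≤∣p∣+∣q∣ : ∀ {n} (p q : Subset n) → ∣ p ∪ q ∣ ≤ ∣ p ∣ + ∣ q ∣
∣p∪q∣≤∣p∣+∣q∣ []            []            = z≤n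
∣p∪q∣≤∣p∣+∣q∣ (inside ∷ p)  (inside ∷ q)  =
  s≤s (≤-trans (∣p∪q∣≤∣p∣+∣q∣ p q) (≤-trans (n≤1+n _) (≤-reflexive (≡.sym (+-suc _ _)))))
∣p∪q∣≤∣p∣+∣q∣ (inside ∷ p)  (outside ∷ q) = s≤s (∣p∪q∣≤∣p∣+∣q∣ p q)
∣p∪q∣≤∣p∣+∣q∣ (outside ∷ p) (inside ∷ q)  = ≤-trans (s≤s (∣p∪q∣≤∣p∣+∣q∣ p q)) (≤-reflexive (≡.sym (+-suc _ _)))
∣p∪q∣≤∣p∣+∣q∣ (outside ∷ p) (outside ∷ q) = ∣p∪q∣≤∣p∣+∣q∣ p q

∣p∪⁅x⁆∣≤1+∣p∣ : ∀ {n} (p : Subset n) x → ∣ p ∪ ⁅ x ⁆ ∣ ≤ suc ∣ p ∣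
∣p∪⁅x⁆∣≤1+∣p∣ p x = ≤-trans (∣p∪q∣≤∣p∣+∣q∣ p ⁅ x ⁆) (≤-reflexive (trans (cong (∣ p ∣ +_) (∣⁅x⁆∣≡1 x)) (+-comm _ 1)))

x∉p⇒∣p∪⁅x⁆∣≡1+∣p∣ : ∀ {n} {p : Subset n} {x} → x ∉ p → ∣ p ∪ ⁅ x ⁆ ∣ ≡ suc ∣ p ∣
x∉p⇒∣p∪⁅x⁆∣≡1+∣p∣ {p = p} {x} x∉p =
  ≤-antisym (∣p∪⁅x⁆∣≤1+∣p∣ p x) (p⊂q⇒∣p∣<∣q∣ (p⊆p∪q ⁅ x ⁆ , x , x∈p∪q⁺ (inj₂ (x∈⁅x⁆ x)) , x∉p))

x∈p∪⁅y⁆⇒x∈p⊎x≡y : ∀ {n} {p : Subset n} {x y} → x ∈ p ∪ ⁅ y ⁆ → x ∈ p ⊎ x ≡ y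
x∈p∪⁅y⁆⇒x∈p⊎x≡y {p = p} {y = y} x∈ with x∈p∪q⁻ p ⁅ y ⁆ x∈
... | inj₁ x∈p    = inj₁ x∈p
... | inj₂ x∈⁅y⁆ = inj₂ (x∈⁅y⁆⇒x≡y y x∈⁅y⁆)

x∈p⇒⁅x⁆⊆p : ∀ {n} {p : Subset n} {x} → x ∈ p → ⁅ x ⁆ ⊆ p
x∈p⇒⁅x⁆⊆p {x = x} x∈p y∈⁅x⁆ rewrite x∈⁅y⁆⇒x≡y x y∈⁅x⁆ = x∈p

p⊆q∧x∈q⇒p∪⁅x⁆⊆q : ∀ {n} {p q : Subset n} {x} → p ⊆ q → x ∈ q → p ∪ ⁅ x ⁆ ⊆ q
p⊆q∧x∈q⇒p∪⁅x⁆⊆q p⊆q x∈q y∈ with x∈p∪⁅y⁆⇒x∈p⊎x≡y y∈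
... | inj₁ y∈p  = p⊆q y∈p
... | inj₂ refl = x∈q

¬Nonempty⇒∣p∣≡0 : ∀ {n} {p : Subset n} → ¬ Nonempty p → ∣ p ∣ ≡ 0
¬Nonempty⇒∣p∣≡0 {n} empty = trans (cong ∣_∣ (Empty-unique empty)) (∣⊥∣≡0 n)

p⊆q∧∣q∣≤∣p∣⇒q⊆p : ∀ {n} {p q : Subset n} → p ⊆ q → ∣ q ∣ ≤ ∣ p ∣ → q ⊆ p
p⊆q∧∣q∣≤∣p∣⇒q⊆p {p = p} p⊆q ∣q∣≤∣p∣ {x} x∈q =
  decidable-stable (x ∈? p) λ x∉p → <⇒≱ (p⊂q⇒∣p∣<∣q∣ (p⊆q , x , x∈q , x∉p)) ∣q∣≤∣p∣

∃-⊆-between : ∀ {n} (A B : Subset n) m → B ⊆ A → ∣ B ∣ ≤ m → m ≤ ∣ A ∣ →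
  ∃ λ S → B ⊆ S × S ⊆ A × ∣ S ∣ ≡ m
∃-⊆-between []            []            zero    _   _ _ = [] , (λ x → x) , (λ x → x) , refl
∃-⊆-between (outside ∷ A) (inside ∷ B)  m       B⊆A _ _ with B⊆A here
... | ()
∃-⊆-between (outside ∷ A) (outside ∷ B) m       B⊆A ∣B∣≤m m≤∣A∣
  with S , B⊆S , S⊆A , ∣S∣≡m ← ∃-⊆-between A B m (drop-∷-⊆ B⊆A) ∣B∣≤m m≤∣A∣ =
  outside ∷ S , s⊆s B⊆S , s⊆s S⊆A , ∣S∣≡m
∃-⊆-between (inside ∷ A)  (inside ∷ B)  (suc m) B⊆A (s≤s ∣B∣≤m) (s≤s m≤∣A∣)
  with S , B⊆S , S⊆A , ∣S∣≡m ← ∃-⊆-between A B m (drop-∷-⊆ B⊆A) ∣B∣≤m m≤∣A∣ =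
  inside ∷ S , s⊆s B⊆S , s⊆s S⊆A , cong suc ∣S∣≡m
∃-⊆-between (inside ∷ A)  (outside ∷ B) m       B⊆A ∣B∣≤m m≤1+∣A∣ with m ≤? ∣ A ∣
... | yes m≤∣A∣
  with S , B⊆S , S⊆A , ∣S∣≡m ← ∃-⊆-between A B m (drop-∷-⊆ B⊆A) ∣B∣≤m m≤∣A∣ =
  outside ∷ S , s⊆s B⊆S , out⊆ S⊆A , ∣S∣≡m
... | no m≰∣A∣ = inside ∷ A , out⊆ (drop-∷-⊆ B⊆A) , ⊆-refl , ≤-antisym (≰⇒> m≰∣A∣) m≤1+∣A∣

grow-induction : ∀ {n} (P : Subset n → Set) {A : Subset n} {r : Fin n} → r ∈ A → P ⁅ r ⁆ →
  (∀ {T b} → T ⊆ A → r ∈ T → P T → b ∈ A → b ∉ T → ∃ λ c → c ∈ A × c ∉ T × P (T ∪ ⁅ c ⁆)) →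
  P A
grow-induction {n} P {A} {r} r∈A P⁅r⁆ step =
  go n ⁅ r ⁆ (≤-trans (∣p∣≤n A) (m≤m+n n _)) (x∈p⇒⁅x⁆⊆p r∈A) (x∈⁅x⁆ r) P⁅r⁆
  where
  go : ∀ f T → ∣ A ∣ ≤ f + ∣ T ∣ → T ⊆ A → r ∈ T → P T → P A
  go f T bound T⊆A r∈T PT with any? (λ b → b ∈? A ×-dec ¬? (b ∈? T))
  ... | no noneMissing =
    subst P (⊆-antisym T⊆A λ {x} x∈A → decidable-stable (x ∈? T) λ x∉T → noneMissing (x , x∈A , x∉T)) PT
  ... | yes (b , b∈A , b∉T) with f | step T⊆A r∈T PT b∈A b∉T
  ...   | zero   | _ = contradiction bound (<⇒≱ (p⊂q⇒∣p∣<∣q∣ (T⊆A , b , b∈A , b∉T)))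
  ...   | suc f′ | c , c∈A , c∉T , PT′ =
    go f′ (T ∪ ⁅ c ⁆)
      (≤-trans bound (≤-reflexive (trans (≡.sym (+-suc f′ _)) (cong (f′ +_) (≡.sym (x∉p⇒∣p∪⁅x⁆∣≡1+∣p∣ c∉T))))))
      (p⊆q∧x∈q⇒p∪⁅x⁆⊆q T⊆A c∈A) (p⊆p∪q ⁅ c ⁆ r∈T) PT′

crossing-step : ∀ {n} {R : Fin n → Fin n → Set} (T : Subset n) {u v} →
  Star R u v → u ∈ T → v ∉ T → ∃₂ λ x y → R x y × x ∈ T × y ∉ T
crossing-step T ε u∈T v∉T = contradiction u∈T v∉T
crossing-step T {u} (_◅_ {j = w} uRw w⇝v) u∈T v∉T with w ∈? T
... | yes w∈T = crossing-step T w⇝v w∈T v∉T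
... | no  w∉T = u , w , uRw , u∈T , w∉T

sumFin-cong : ∀ n {f g : Fin n → ℕ} → (∀ i → f i ≡ g i) → sumFin n f ≡ sumFin n g
sumFin-cong zero    f≗g = refl
sumFin-cong (suc n) f≗g = cong₂ _+_ (f≗g fzero) (sumFin-cong n (f≗g ∘ fsuc))

sumFin-zero : ∀ n {f : Fin n → ℕ} → (∀ i → f i ≡ 0) → sumFin n f ≡ 0
sumFin-zero zero    f≗0 = refl
sumFin-zero (suc n) f≗0 = cong₂ _+_ (f≗0 fzero) (sumFin-zero n (f≗0 ∘ fsuc))

sumFin-mono : ∀ n {f g : Fin n → ℕ} → (∀ i → f i ≤ g i) → sumFin n f ≤ sumFin n g
sumFin-mono zero    f≤g = z≤n
sumFin-mono (suc n) f≤g = +-mono-≤ (f≤g fzero) (sumFin-mono n (f≤g ∘ fsuc))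

sumFin-suc-at : ∀ n {f g : Fin n → ℕ} (i₀ : Fin n) → (∀ i → i ≢ i₀ → f i ≡ g i) → f i₀ ≡ suc (g i₀) →
  sumFin n f ≡ suc (sumFin n g)
sumFin-suc-at (suc n) fzero f≗g fi₀ =
  cong₂ _+_ fi₀ (sumFin-cong n λ i → f≗g (fsuc i) λ ())
sumFin-suc-at (suc n) {g = g} (fsuc i₀) f≗g fi₀ =
  trans (cong₂ _+_ (f≗g fzero λ ()) (sumFin-suc-at n i₀ (λ i i≢i₀ → f≗g (fsuc i) (i≢i₀ ∘ suc-injective)) fi₀))
        (+-suc (g fzero) _)

BoolRel : ℕ → Set
BoolRel n = Fin n → Fin n → Bool

pairTerm : ∀ {n} → BoolRel n → Fin n → Fin n → ℕ
pairTerm F i j = if does (toℕ i <? toℕ j) then (if F i j then 1 else 0) else 0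

-- pairCount (F H) is edgeCount H by definition.
pairCount : ∀ {n} → BoolRel n → ℕ
pairCount {n} F = sumFin n λ i → sumFin n λ j → pairTerm F i j

_⇒ᵇ_ : ∀ {n} → BoolRel n → BoolRel n → Set
F ⇒ᵇ F′ = ∀ i j → F i j ≡ true → F′ i j ≡ true

pairTerm-mono : ∀ {n} {F F′ : BoolRel n} → F ⇒ᵇ F′ → ∀ i j → pairTerm F i j ≤ pairTerm F′ i j
pairTerm-mono {F = F} F⇒F′ i j with does (toℕ i <? toℕ j) | F i j in Fij
... | false | _     = z≤n
... | true  | false = z≤n
... | true  | true  rewrite F⇒F′ i j Fij = ≤-refl

pairTerm-cong : ∀ {n} {F F′ : BoolRel n} i j → (toℕ i < toℕ j → F′ i j ≡ F i j) → pairTerm F′ i j ≡ pairTerm F i j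
pairTerm-cong i j agree with toℕ i <? toℕ j
... | yes i<j rewrite dec-true (toℕ i <? toℕ j) i<j | agree i<j = refl
... | no  i≮j rewrite dec-false (toℕ i <? toℕ j) i≮j = refl

pairTerm-insert : ∀ {n} {F F′ : BoolRel n} {a c} → toℕ a < toℕ c → F a c ≡ false → F′ a c ≡ true →
  pairTerm F′ a c ≡ suc (pairTerm F a c)
pairTerm-insert {a = a} {c} a<c Fac F′ac rewrite dec-true (toℕ a <? toℕ c) a<c | Fac | F′ac = refl

pairCount-mono : ∀ {n} {F F′ : BoolRel n} → F ⇒ᵇ F′ → pairCount F ≤ pairCount F′
pairCount-mono {n} F⇒F′ = sumFin-mono n λ i → sumFin-mono n λ j → pairTerm-mono F⇒F′ i j

pairCount-const-false : ∀ {n} → pairCount {n} (λ _ _ → false) ≡ 0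
pairCount-const-false {n} = sumFin-zero n λ i → sumFin-zero n λ j → pairTerm-false i j
  where
  pairTerm-false : ∀ i j → pairTerm (λ _ _ → false) i j ≡ 0
  pairTerm-false i j with does (toℕ i <? toℕ j)
  ... | true  = refl
  ... | false = refl

pairCount-insert : ∀ {n} {F F′ : BoolRel n} {a c} → toℕ a < toℕ c → F a c ≡ false → F′ a c ≡ true →
  (∀ i j → toℕ i < toℕ j → ¬ (i ≡ a × j ≡ c) → F′ i j ≡ F i j) → pairCount F′ ≡ suc (pairCount F)
pairCount-insert {n} {F} {F′} {a} {c} a<c Fac F′ac agree =
  sumFin-suc-at n a
    (λ i i≢a → sumFin-cong n λ j → pairTerm-cong {F = F} {F′} i j λ i<j → agree i j i<j (i≢a ∘ proj₁))
    (sumFin-suc-at n c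
      (λ j j≢c → pairTerm-cong {F = F} {F′} a j λ a<j → agree a j a<j (j≢c ∘ proj₂))
      (pairTerm-insert {F = F} {F′} a<c Fac F′ac))

Joins : ∀ {n} → Fin n → Fin n → Fin n → Fin n → Set
Joins a c x y = (x ≡ a × y ≡ c) ⊎ (x ≡ c × y ≡ a)

joins? : ∀ {n} (a c x y : Fin n) → Dec (Joins a c x y)
joins? a c x y = (x ≟ a ×-dec y ≟ c) ⊎-dec (x ≟ c ×-dec y ≟ a)

link : ∀ {n} → Fin n → Fin n → BoolRel n
link a c x y = does (joins? a c x y)

link⁻ : ∀ {n} {a c x y : Fin n} → link a c x y ≡ true → Joins a c x y
link⁻ {a = a} {c} {x} {y} = does≡true⇒ (joins? a c x y)
  where
  does≡true⇒ : ∀ {P : Set} (P? : Dec P) → does P? ≡ true → P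
  does≡true⇒ (yes p) _  = p
  does≡true⇒ (no _)  ()

link-sym : ∀ {n} (a c x y : Fin n) → link a c x y ≡ link a c y x
link-sym a c x y = does-⇔ (mk⇔ swap swap) (joins? a c x y) (joins? a c y x)
  where
  swap : ∀ {x y} → Joins a c x y → Joins a c y x
  swap (inj₁ (x≡a , y≡c)) = inj₂ (y≡c , x≡a)
  swap (inj₂ (x≡c , y≡a)) = inj₁ (y≡a , x≡c)

∨-≡true⁻ : ∀ x {y} → x ∨ y ≡ true → x ≡ true ⊎ y ≡ true
∨-≡true⁻ true  _  = inj₁ refl
∨-≡true⁻ false eq = inj₂ eq

∨-link-true : ∀ {n} (F : BoolRel n) {a c x y} → Joins a c x y → F x y ∨ link a c x y ≡ true
∨-link-true F {a} {c} {x} {y} j = trans (cong (F x y ∨_) (dec-true (joins? a c x y) j)) (∨-zeroʳ _)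

∨-link-false : ∀ {n} (F : BoolRel n) {a c x y} → ¬ Joins a c x y → F x y ∨ link a c x y ≡ F x y
∨-link-false F {a} {c} {x} {y} ¬j = trans (cong (F x y ∨_) (dec-false (joins? a c x y) ¬j)) (∨-identityʳ _)

pairCount-∨-link : ∀ {n} {F : BoolRel n} {a c} → (∀ x y → F x y ≡ F y x) → a ≢ c → F a c ≡ false →
  pairCount (λ x y → F x y ∨ link a c x y) ≡ suc (pairCount F)
pairCount-∨-link {F = F} {a} {c} F-sym a≢c Fac with <-cmp (toℕ a) (toℕ c)
... | tri< a<c _ _ =
  pairCount-insert a<c Fac (∨-link-true F (inj₁ (refl , refl)))
    λ i j i<j ¬ac → ∨-link-false F λ { (inj₁ ac) → ¬ac ac ; (inj₂ (refl , refl)) → <-asym a<c i<j }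
... | tri≈ _ a≡c _ = contradiction (toℕ-injective a≡c) a≢c
... | tri> _ _ c<a =
  pairCount-insert c<a (trans (F-sym c a) Fac) (∨-link-true F (inj₂ (refl , refl)))
    λ i j i<j ¬ca → ∨-link-false F λ { (inj₁ (refl , refl)) → <-asym c<a i<j ; (inj₂ ca) → ¬ca ca }

edgeCount-mono : ∀ {n} {G G′ : Graph n} (H : ConnectedSubgraph G) (H′ : ConnectedSubgraph G′) →
  F H ⇒ᵇ F H′ → edgeCount H ≤ edgeCount H′
edgeCount-mono H H′ = pairCount-mono

asGraph : ∀ {n} {G : Graph n} → ConnectedSubgraph G → Graph n
asGraph {G = G} H = record { adj = F H ; sym = F-sym H ; irrefl = loopless }
  where
  loopless : ∀ u → F H u u ≡ false
  loopless u with F H u u in Fuu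
  ... | false = refl
  ... | true  = contradiction (trans (≡.sym (F⊆E H u u Fuu)) (irrefl G u)) λ ()

addLeaf : ∀ {n} {G : Graph n} (H : ConnectedSubgraph G) {a c} → adj G a c ≡ true → a ∈ U H →
  ConnectedSubgraph G
addLeaf {G = G} H {a} {c} Eac a∈U = record
  { U = U H ∪ ⁅ c ⁆ ; F = F′ ; F-sym = F′-sym ; F⊆E = F′⊆E ; F-ends = F′-ends
  ; conn = λ u v u∈ v∈ → Star.reverse (λ {x} {y} → trans (F′-sym y x)) (walk u∈) ◅◅ walk v∈ }
  where
  F′ : BoolRel _
  F′ x y = F H x y ∨ link a c x y

  F′-sym : ∀ x y → F′ x y ≡ F′ y x
  F′-sym x y = cong₂ _∨_ (F-sym H x y) (link-sym a c x y)

  F′⊆E : ∀ x y → F′ x y ≡ true → adj G x y ≡ true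
  F′⊆E x y F′xy with ∨-≡true⁻ (F H x y) F′xy
  ... | inj₁ Fxy = F⊆E H x y Fxy
  ... | inj₂ linked with link⁻ {a = a} {c} {x} {y} linked
  ...   | inj₁ (refl , refl) = Eac
  ...   | inj₂ (refl , refl) = trans (sym G c a) Eac

  F′-ends : ∀ x y → F′ x y ≡ true → x ∈ U H ∪ ⁅ c ⁆
  F′-ends x y F′xy with ∨-≡true⁻ (F H x y) F′xy
  ... | inj₁ Fxy = p⊆p∪q ⁅ c ⁆ (F-ends H x y Fxy)
  ... | inj₂ linked with link⁻ {a = a} {c} {x} {y} linked
  ...   | inj₁ (refl , refl) = p⊆p∪q ⁅ c ⁆ a∈U
  ...   | inj₂ (refl , refl) = x∈p∪q⁺ (inj₂ (x∈⁅x⁆ c))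

  walk : ∀ {x} → x ∈ U H ∪ ⁅ c ⁆ → Star (λ u v → F′ u v ≡ true) a x
  walk {x} x∈ with x∈p∪⁅y⁆⇒x∈p⊎x≡y x∈
  ... | inj₁ x∈U  = Star.map (λ {u} {v} Fuv → cong (_∨ link a c u v) Fuv) (conn H a x a∈U x∈U)
  ... | inj₂ refl = ∨-link-true (F H) (inj₁ (refl , refl)) ◅ ε

edgeCount-addLeaf : ∀ {n} {G : Graph n} (H : ConnectedSubgraph G) {a c} (Eac : adj G a c ≡ true) (a∈U : a ∈ U H) →
  c ∉ U H → edgeCount (addLeaf H Eac a∈U) ≡ suc (edgeCount H)
edgeCount-addLeaf H {a} {c} Eac a∈U c∉U = pairCount-∨-link (F-sym H) a≢c Fac
  where
  a≢c : a ≢ c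
  a≢c refl = c∉U a∈U
  Fac : F H a c ≡ false
  Fac with F H a c in Fac
  ... | false = refl
  ... | true  = contradiction (F-ends H c a (trans (F-sym H c a) Fac)) c∉U

-- Connectivity of the subgraph induced by S, in the form "every cut of S is crossed by an
-- edge", which (unlike the existence of walks) can be decided.
CutConnected : ∀ {n} → Graph n → Subset n → Set
CutConnected G S = ∀ {T a b} → T ⊆ S → a ∈ T → b ∈ S → b ∉ T →
  ∃₂ λ x y → adj G x y ≡ true × x ∈ T × y ∈ S × y ∉ T

spanningTree : ∀ {n} {G : Graph n} {S : Subset n} {r} → CutConnected G S → r ∈ S →
  Σ (ConnectedSubgraph G) λ H → U H ≡ S × suc (edgeCount H) ≡ ∣ S ∣
spanningTree {n} {G} {S} {r} cut r∈S = grow-induction SpannedBy r∈S single addVertex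
  where
  SpannedBy : Subset n → Set
  SpannedBy T = Σ (ConnectedSubgraph G) λ H → U H ≡ T × suc (edgeCount H) ≡ ∣ T ∣

  single : SpannedBy ⁅ r ⁆
  single = record { U = ⁅ r ⁆ ; F = λ _ _ → false ; F-sym = λ _ _ → refl ; F⊆E = λ _ _ ()
                  ; F-ends = λ _ _ ()
                  ; conn = λ u v u∈ v∈ → subst (Star _ u) (trans (x∈⁅y⁆⇒x≡y r u∈) (≡.sym (x∈⁅y⁆⇒x≡y r v∈))) ε }
         , refl , trans (cong suc (pairCount-const-false {n})) (≡.sym (∣⁅x⁆∣≡1 r))

  addVertex : ∀ {T b} → T ⊆ S → r ∈ T → SpannedBy T → b ∈ S → b ∉ T →
    ∃ λ c → c ∈ S × c ∉ T × SpannedBy (T ∪ ⁅ c ⁆)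
  addVertex T⊆S r∈T (H , refl , ∣H∣) b∈S b∉T
    with x , y , Exy , x∈T , y∈S , y∉T ← cut T⊆S r∈T b∈S b∉T =
    y , y∈S , y∉T , addLeaf H Exy x∈T , refl ,
    trans (cong suc (edgeCount-addLeaf H Exy x∈T y∉T)) (trans (cong suc ∣H∣) (≡.sym (x∉p⇒∣p∪⁅x⁆∣≡1+∣p∣ y∉T)))

cutConnected-U : ∀ {n} {G : Graph n} (H : ConnectedSubgraph G) → CutConnected (asGraph H) (U H)
cutConnected-U H {T} {a} T⊆U a∈T b∈U b∉T
  with x , y , Fxy , x∈T , y∉T ← crossing-step T (conn H a _ (T⊆U a∈T) b∈U) a∈T b∉T =
  x , y , Fxy , x∈T , F-ends H y x (trans (F-sym H y x) Fxy) , y∉T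

∣U∣≤1+edgeCount : ∀ {n} {G : Graph n} (H : ConnectedSubgraph G) → ∣ U H ∣ ≤ suc (edgeCount H)
∣U∣≤1+edgeCount H with nonempty? (U H)
... | no  empty = ≤-trans (≤-reflexive (¬Nonempty⇒∣p∣≡0 empty)) z≤n
... | yes (r , r∈U) with T , refl , ∣T∣ ← spanningTree {G = asGraph H} (cutConnected-U H) r∈U =
  ≤-trans (≤-reflexive (≡.sym ∣T∣)) (s≤s (edgeCount-mono T H (F⊆E T)))

complete? : ∀ {n} (G : Graph n) → Dec (Complete G)
complete? G = all? λ u → all? λ v → ¬? (u ≟ v) →-dec (adj G u v ≟ᵇ true)

cutConnected-if-few-removed : ∀ {n} {G : Graph n} {k} {S : Subset n} →
  ConnectivityAtLeast G k → ∣ ∁ S ∣ < k → CutConnected G S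
cutConnected-if-few-removed {G = G} {S = S} κ≥k ∣∁S∣<k {T} {a} {b} T⊆S a∈T b∈S b∉T
  with any? (λ x → any? λ y → adj G x y ≟ᵇ true ×-dec x ∈? T ×-dec y ∈? S ×-dec ¬? (y ∈? T))
... | yes crossing = crossing
... | no noCrossing with κ≥k
...   | inj₁ (complete , _) =
  contradiction (a , b , complete a b (λ { refl → b∉T a∈T }) , a∈T , b∈S , b∉T) noCrossing
...   | inj₂ (_ , separators≥k) = contradiction (separators≥k (∁ S) separated) (<⇒≱ ∣∁S∣<k)
  where
  separated : DisconnectedAfterRemoving G (∁ S)
  separated = a , b , x∈p⇒x∉∁p (T⊆S a∈T) , x∈p⇒x∉∁p b∈S , λ walk →
    let x , y , (Exy , _ , y∉∁S) , x∈T , y∉T = crossing-step T walk a∈T b∉T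
    in noCrossing (x , y , Exy , x∈T , x∉∁p⇒x∈p y∉∁S , y∉T)

walk-outside : ∀ {n} {G : Graph n} {X : Subset n} (H : ConnectedSubgraph G) → U H ⊆ ∁ X →
  ∀ {u v} → u ∈ U H → v ∈ U H → Star (λ a b → adj G a b ≡ true × a ∉ X × b ∉ X) u v
walk-outside {G = G} {X} H U⊆∁X u∈U v∈U = Star.map step (conn H _ _ u∈U v∈U)
  where
  step : ∀ {a b} → F H a b ≡ true → adj G a b ≡ true × a ∉ X × b ∉ X
  step {a} {b} Fab = F⊆E H a b Fab , x∈∁p⇒x∉p (U⊆∁X (F-ends H a b Fab))
                   , x∈∁p⇒x∉p (U⊆∁X (F-ends H b a (trans (F-sym H b a) Fab)))

walk-if-few-removed : ∀ {n} {G : Graph n} {X : Subset n} {m u v} →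
  (∀ S → ∣ S ∣ ≡ m → Σ (ConnectedSubgraph G) λ H → S ⊆ U H × suc (edgeCount H) ≤ m) →
  2 ≤ m → m ≤ n ∸ ∣ X ∣ → u ∉ X → v ∉ X → Star (λ a b → adj G a b ≡ true × a ∉ X × b ∉ X) u v
walk-if-few-removed {X = X} {m} {u} {v} steiner 2≤m m≤n∸∣X∣ u∉X v∉X
  with S , uv⊆S , S⊆∁X , ∣S∣≡m ← ∃-⊆-between (∁ X) (⁅ u ⁆ ∪ ⁅ v ⁆) m
      (p⊆q∧x∈q⇒p∪⁅x⁆⊆q (x∈p⇒⁅x⁆⊆p (x∉p⇒x∈∁p u∉X)) (x∉p⇒x∈∁p v∉X))
      (≤-trans (∣p∪⁅x⁆∣≤1+∣p∣ ⁅ u ⁆ v) (≤-trans (≤-reflexive (cong suc (∣⁅x⁆∣≡1 u))) 2≤m))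
      (≤-trans m≤n∸∣X∣ (≤-reflexive (≡.sym (∣∁p∣≡n∸∣p∣ X))))
  with H , S⊆U , ∣H∣≤m ← steiner S ∣S∣≡m =
  walk-outside H (⊆-trans U⊆S S⊆∁X)
    (S⊆U (uv⊆S (p⊆p∪q ⁅ v ⁆ (x∈⁅x⁆ u)))) (S⊆U (uv⊆S (x∈p∪q⁺ (inj₂ (x∈⁅x⁆ v)))))
  where
  U⊆S : U H ⊆ S
  U⊆S = p⊆q∧∣q∣≤∣p∣⇒q⊆p S⊆U (≤-trans (∣U∣≤1+edgeCount H) (≤-trans ∣H∣≤m (≤-reflexive (≡.sym ∣S∣≡m))))

n∸k+1≤n∸x : ∀ {n k x} → x < k → k ≤ n → n ∸ k + 1 ≤ n ∸ x
n∸k+1≤n∸x {n} {k} {x} x<k k≤n = m+n≤o⇒m≤o∸n (n ∸ k + 1) (begin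
  n ∸ k + 1 + x   ≡⟨ +-assoc (n ∸ k) 1 x ⟩
  n ∸ k + suc x   ≤⟨ +-monoʳ-≤ (n ∸ k) x<k ⟩
  n ∸ k + k       ≡⟨ m∸n+n≡m k≤n ⟩
  n               ∎)
  where open ≤-Reasoning

n∸[n∸k+1]<k : ∀ {n k} → 1 ≤ k → k ≤ n → n ∸ (n ∸ k + 1) < k
n∸[n∸k+1]<k {n} {k} 1≤k k≤n = begin-strict
  n ∸ (n ∸ k + 1) <⟨ ∸-monoʳ-< (m<m+n (n ∸ k) (s≤s z≤n)) (n∸k+1≤n∸x 1≤k k≤n) ⟩
  n ∸ (n ∸ k)     ≡⟨ m∸[m∸n]≡n k≤n ⟩
  k               ∎
  where open ≤-Reasoning

2≤n∸k+1 : ∀ {n k} → k < n → 2 ≤ n ∸ k + 1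
2≤n∸k+1 k<n = +-monoˡ-≤ 1 (m<n⇒0<n∸m k<n)

module Proposition1 (k n : ℕ) (1≤k : 1 ≤ k) (k+2≤n : k + 2 ≤ n) (G : Graph n) where

  m : ℕ
  m = n ∸ k + 1

  k<n : k < n
  k<n = <-≤-trans (m<m+n k (s≤s z≤n)) k+2≤n

  m≡1+n∸k : m ≡ suc (n ∸ k)
  m≡1+n∸k = +-comm (n ∸ k) 1

  ∣∁S∣<k : ∀ S → ∣ S ∣ ≡ m → ∣ ∁ S ∣ < k
  ∣∁S∣<k S ∣S∣≡m = begin-strict
    ∣ ∁ S ∣   ≡⟨ ∣∁p∣≡n∸∣p∣ S ⟩
    n ∸ ∣ S ∣ ≡⟨ cong (n ∸_) ∣S∣≡m ⟩
    n ∸ m     <⟨ n∸[n∸k+1]<k 1≤k (<⇒≤ k<n) ⟩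
    k         ∎
    where open ≤-Reasoning

  forward : ConnectivityAtLeast G k → SteinerDiamIs G m (n ∸ k)
  forward κ≥k = spanning , hardSet
    where
    spanning : ∀ S → ∣ S ∣ ≡ m → Σ (ConnectedSubgraph G) λ H → S ⊆ U H × edgeCount H ≤ n ∸ k
    spanning S ∣S∣≡m with nonempty? S
    ... | no empty =
      contradiction (trans (≡.sym ∣S∣≡m) (¬Nonempty⇒∣p∣≡0 empty)) (>⇒≢ (≤-trans (s≤s z≤n) (2≤n∸k+1 k<n)))
    ... | yes (r , r∈S)
      with H , refl , ∣H∣ ← spanningTree (cutConnected-if-few-removed {G = G} κ≥k (∣∁S∣<k S ∣S∣≡m)) r∈S =
      H , ⊆-refl , ≤-pred (≤-reflexive (trans ∣H∣ (trans ∣S∣≡m m≡1+n∸k)))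
    hardSet : Σ (Subset n) λ S → ∣ S ∣ ≡ m × (∀ H → S ⊆ U H → n ∸ k ≤ edgeCount H)
    hardSet with S , _ , _ , ∣S∣≡m ← ∃-⊆-between ⊤ ⊥ m ⊥⊆ (≤-trans (≤-reflexive (∣⊥∣≡0 n)) z≤n)
                                         (≤-trans (n∸k+1≤n∸x 1≤k (<⇒≤ k<n)) (≤-reflexive (≡.sym (∣⊤∣≡n n)))) =
      S , ∣S∣≡m , λ H S⊆U → ≤-pred (begin
        suc (n ∸ k)          ≡⟨ ≡.sym (trans ∣S∣≡m m≡1+n∸k) ⟩
        ∣ S ∣               ≤⟨ p⊆q⇒∣p∣≤∣q∣ S⊆U ⟩
        ∣ U H ∣             ≤⟨ ∣U∣≤1+edgeCount H ⟩
        suc (edgeCount H)    ∎)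
      where open ≤-Reasoning

  backward : SteinerDiamIs G m (n ∸ k) → ConnectivityAtLeast G k
  backward (steiner , _) with complete? G
  ... | yes complete  = inj₁ (complete , m+n≤o⇒m≤o∸n k (≤-trans (+-monoʳ-≤ k (s≤s z≤n)) k+2≤n))
  ... | no  ¬complete = inj₂ (¬complete , separator≥k)
    where
    steiner′ : ∀ S → ∣ S ∣ ≡ m → Σ (ConnectedSubgraph G) λ H → S ⊆ U H × suc (edgeCount H) ≤ m
    steiner′ S ∣S∣≡m with H , S⊆U , edges≤ ← steiner S ∣S∣≡m =
      H , S⊆U , ≤-trans (s≤s edges≤) (≤-reflexive (≡.sym m≡1+n∸k))
    separator≥k : ∀ X → DisconnectedAfterRemoving G X → k ≤ ∣ X ∣
    separator≥k X (u , v , u∉X , v∉X , noWalk) = decidable-stable (k ≤? ∣ X ∣) λ k≰∣X∣ →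
      noWalk (walk-if-few-removed steiner′ (2≤n∸k+1 k<n) (n∸k+1≤n∸x (≰⇒> k≰∣X∣) (<⇒≤ k<n)) u∉X v∉X)

proposition1 : (k n : ℕ) → 1 ≤ k → k + 2 ≤ n → (G : Graph n) →
    ConnectivityAtLeast G k ⇔ SteinerDiamIs G (n ∸ k + 1) (n ∸ k)
proposition1 k n 1≤k k+2≤n G = mk⇔ forward backward
  where open Proposition1 k n 1≤k k+2≤n G
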